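{- Let $n\ge3$ and let $T_n$ be the graph with vertex set $\{1,\ldots,n\}$ and edge set $\{(1,3),(2,3),(3,4),(4,5),\ldots,(n-1,n)\}$. Then the total number of spanning rooted forests of $T_n$ is $f=4\mathcal F_{2n-3}$, and $f_{33}=4\mathcal F_{2n-5}$ and $f_{nn}=4\mathcal F_{2n-4}$.
   Context: $(\mathcal F_k)_{k\ge0}$ are the Fibonacci numbers ($\mathcal F_0=0$, $\mathcal F_1=1$, $\mathcal F_{k+2}=\mathcal F_{k+1}+\mathcal F_k$). A spanning rooted forest of a graph is a spanning acyclic subgraph in which exactly one vertex (the root) is marked in each tree. $f_{ii}$ is the number of spanning rooted forests in which vertex $i$ is a root; $f$ is the total number of spanning rooted forests. $T_n$ is called a T-caterpillar. -}

module Defs where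

open import Data.Nat using (ℕ; zero; suc; _+_; _≤_)
open import Data.Fin using (Fin; zero; suc; _↑ʳ_; inject₁)
open import Data.Fin.Subset using (Subset; _∈_)
open import Data.Product using (Σ; ∃; _×_; _,_)
open import Data.Sum using (_⊎_)
open import Data.Unit using (⊤)
open import Data.List using (List; []; _∷_; _++_; [_]; length; lookup; tabulate)
open import Data.List.Relation.Unary.Unique.Propositional using (Unique)
open import Data.List.Membership.Propositional renaming (_∈_ to _∈ₗ_)
open import Relation.Nullary using (¬_)
open import Relation.Binary.PropositionalEquality using (_≡_)
open import Relation.Binary.Construct.Closure.ReflexiveTransitive using (Star)
open import Function using (_⇔_)

fib : ℕ → ℕ
fib zero = zero
fib (suc zero) = suc zero
fib (suc (suc k)) = fib (suc k) + fib k

-- A (simple, undirected) graph on vertex set Fin n is given by a list of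
-- edges E; vertex i of the paper is Fin index i - 1.
-- A spanning subgraph is a subset S of the edge indices Fin (length E).

module _ {n : ℕ} (E : List (Fin n × Fin n)) where

  EdgeSet : Set
  EdgeSet = Subset (length E)

  Adj : EdgeSet → Fin n → Fin n → Set
  Adj S u v = Σ (Fin (length E)) λ e → e ∈ S × (lookup E e ≡ (u , v) ⊎ lookup E e ≡ (v , u))

  Chain : EdgeSet → List (Fin n) → Set
  Chain S (x ∷ y ∷ rest) = Adj S x y × Chain S (y ∷ rest)
  Chain S _ = ⊤

  Cycle : EdgeSet → Set
  Cycle S = Σ (Fin n) λ v → Σ (List (Fin n)) λ vs →
              2 ≤ length vs × Unique (v ∷ vs) × Chain S (v ∷ vs ++ [ v ])

  Acyclic : EdgeSet → Set
  Acyclic S = ¬ Cycle S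

  Connected : EdgeSet → Fin n → Fin n → Set
  Connected S = Star (Adj S)

  IsSpanningRootedForest : EdgeSet × Subset n → Set
  IsSpanningRootedForest (S , R) =
    Acyclic S ×
    (∀ v → Σ (Fin n) λ r → r ∈ R × Connected S v r ×
             (∀ r' → r' ∈ R → Connected S v r' → r' ≡ r))

  IsSpanningRootedForestRootedAt : Fin n → EdgeSet × Subset n → Set
  IsSpanningRootedForestRootedAt i (S , R) = IsSpanningRootedForest (S , R) × i ∈ R

HasCount : {A : Set} → (A → Set) → ℕ → Set
HasCount {A} P k = Σ (List A) λ xs → Unique xs × length xs ≡ k × (∀ x → x ∈ₗ xs ⇔ P x)

-- T-caterpillar T_n with n = k + 3 vertices:
-- edges (1,3), (2,3), (3,4), (4,5), …, (n-1,n)   (1-based),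
-- i.e. (0,2), (1,2), (2,3), …, (n-2,n-1) on Fin n.
T-edges : (k : ℕ) → List (Fin (3 + k) × Fin (3 + k))
T-edges k = (zero , suc (suc zero)) ∷ (suc zero , suc (suc zero)) ∷
            tabulate {n = k} (λ j → (2 ↑ʳ inject₁ j , 2 ↑ʳ suc j))

vertex3 : (k : ℕ) → Fin (3 + k)
vertex3 k = suc (suc zero)

vertexN : (k : ℕ) → Fin (3 + k)
vertexN k = Data.Fin.fromℕ (2 + k)

module Submission where

-- T_n is a tree, so every edge subset is acyclic and a spanning rooted forest is an edge subset
-- together with exactly one root in each of its components.  Deleting edges cuts the path
-- 3 – 4 – … – n into segments, and the leaves 1 and 2 either join the segment of vertex 3 or stay
-- isolated (and must then be roots).  Scanning the path edge by edge, the rooted forests are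
-- recognised by an automaton whose state is the number of roots already seen in the current
-- segment.  If c₀, c₁ count the accepted configurations of a path with 0 resp. 1 root already in
-- its first segment, adding an edge maps (c₀ , c₁) to (2c₀ + c₁ , c₀ + c₁), which advances the
-- Fibonacci numbers by two.  A pendant leaf turns a count c(e) into 2c(e) + c(e+1), and no
-- segment can hold two roots, so the two leaves give 4(c₀ + c₁).  Prescribing the root at vertex n
-- only changes the initial values of the recursion; prescribing it at vertex 3 leaves c₀ + c₁ for
-- the path with one edge less.

open import Algebra.Properties.CommutativeSemigroup using (x∙yz≈y∙xz)
open import Data.Bool using (Bool; true; false; T; not; _∧_; _∨_)
open import Data.Bool.Properties using (T-≡; T-∧; ∧-assoc; ∧-comm; ∧-identityʳ)
open import Data.Empty using (⊥-elim)
open import Data.Fin as Fin using (Fin; zero; suc; inject₁; fromℕ; toℕ; _↑ʳ_)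
open import Data.Fin.Properties as Finₚ using (0≢1+n; toℕ-inject₁)
open import Data.Fin.Subset using (Subset; _∈_)
open import Data.List as List using (List; []; _∷_; _++_; [_]; length; map; tabulate)
open import Data.List.Properties using (length-map; length-++; length-tabulate; lookup-tabulate)
open import Data.List.Membership.Propositional using () renaming (_∈_ to _∈ₗ_)
open import Data.List.Membership.Propositional.Properties
  using (∈-map⁺; ∈-map⁻; ∈-++⁺ˡ; ∈-++⁺ʳ; ∈-++⁻; ∈-lookup; ∈-tabulate⁻)
open import Data.List.Relation.Unary.All as All using (All; []; _∷_)
open import Data.List.Relation.Unary.AllPairs using ([]; _∷_)
open import Data.List.Relation.Unary.Any using (here; there)
open import Data.List.Relation.Unary.Unique.Propositional using (Unique)
open import Data.List.Relation.Unary.Unique.Propositional.Properties using (map⁺; ++⁺)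
open import Data.Nat using (ℕ; zero; suc; _+_; _*_; _≡ᵇ_; _<_; s≤s; z≤n)
open import Data.Nat.Properties
  using (+-assoc; +-comm; +-identityʳ; +-suc; *-suc; suc-injective; +-cancelˡ-≡; ≡ᵇ⇒≡; ≡⇒≡ᵇ;
         <-trans; <-irrefl; ≤-reflexive; +-commutativeSemigroup)
open import Data.Nat.Tactic.RingSolver using (solve-∀)
open import Data.Product using (Σ; ∃; _×_; _,_; proj₁; proj₂)
open import Data.Product.Function.NonDependent.Propositional using (_×-⇔_)
open import Data.Sum using (_⊎_; inj₁; inj₂; swap)
open import Data.Unit using (⊤; tt)
open import Data.Vec as Vec using (Vec; []; _∷_; lookup; here; there)
open import Data.Vec.Properties as Vecₚ using ([]=⇒lookup; lookup⇒[]=)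
open import Function using (id; _∘_; _⇔_; mk⇔; Equivalence)
open import Function.Construct.Composition using (_⇔-∘_)
open import Function.Construct.Symmetry using (⇔-sym)
open import Level using (0ℓ)
open import Relation.Binary using (Rel; IsEquivalence)
import Relation.Binary.Construct.On as On
open import Relation.Binary.Construct.Closure.ReflexiveTransitive using (ε; _◅_; _◅◅_; reverse)
open import Relation.Binary.PropositionalEquality
  using (_≡_; _≢_; refl; sym; trans; cong; cong₂; subst; module ≡-Reasoning)
open import Relation.Nullary using (¬_)

open import Defs

open Equivalence using (to; from)

-- Counting Boolean predicates on pairs of bit vectors

iverson : Bool → ℕ
iverson true  = 1
iverson false = 0

Σᵇ : (Bool → ℕ) → ℕ
Σᵇ f = f true + f false

HasCount-⇔ : {A : Set} {P Q : A → Set} {n : ℕ} → (∀ x → P x ⇔ Q x) → HasCount P n → HasCount Q n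
HasCount-⇔ P⇔Q (xs , xs! , |xs| , ∈⇔P) = xs , xs! , |xs| , λ x → P⇔Q x ⇔-∘ ∈⇔P x

HasCount-split : {A B : Set} {P : A → Set} {m n : ℕ} (f g : B → A) →
  (∀ {x y} → f x ≡ f y → x ≡ y) → (∀ {x y} → g x ≡ g y → x ≡ y) → (∀ x y → f x ≢ g y) →
  (∀ a → (∃ λ x → f x ≡ a) ⊎ (∃ λ y → g y ≡ a)) →
  HasCount (P ∘ f) m → HasCount (P ∘ g) n → HasCount P (m + n)
HasCount-split {P = P} f g f-inj g-inj f≢g cover (xs , xs! , |xs| , xs⇔) (ys , ys! , |ys| , ys⇔) =
  map f xs ++ map g ys ,
  ++⁺ (map⁺ f-inj xs!) (map⁺ g-inj ys!) disjoint ,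
  trans (length-++ (map f xs)) (cong₂ _+_ (trans (length-map f xs) |xs|) (trans (length-map g ys) |ys|)) ,
  λ a → mk⇔ member⇒P (P⇒member a)
  where
  disjoint : ∀ {a} → ¬ (a ∈ₗ map f xs × a ∈ₗ map g ys)
  disjoint (a∈f , a∈g) with ∈-map⁻ f a∈f | ∈-map⁻ g a∈g
  ... | x , _ , refl | y , _ , fx≡gy = f≢g x y fx≡gy
  member⇒P : ∀ {a} → a ∈ₗ map f xs ++ map g ys → P a
  member⇒P a∈ with ∈-++⁻ (map f xs) a∈
  ... | inj₁ a∈f with ∈-map⁻ f a∈f
  ...   | x , x∈ , refl = to (xs⇔ x) x∈
  member⇒P a∈ | inj₂ a∈g with ∈-map⁻ g a∈g
  ...   | y , y∈ , refl = to (ys⇔ y) y∈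
  P⇒member : ∀ a → P a → a ∈ₗ map f xs ++ map g ys
  P⇒member a Pa with cover a
  ... | inj₁ (x , refl) = ∈-++⁺ˡ (∈-map⁺ f (from (xs⇔ x) Pa))
  ... | inj₂ (y , refl) = ∈-++⁺ʳ (map f xs) (∈-map⁺ g (from (ys⇔ y) Pa))

module _ {B : Set} where

  HasCount-∷ˡ : ∀ {k a b} {P : Vec Bool (suc k) × B → Set} →
    HasCount (λ x → P (true ∷ proj₁ x , proj₂ x)) a → HasCount (λ x → P (false ∷ proj₁ x , proj₂ x)) b →
    HasCount P (a + b)
  HasCount-∷ˡ = HasCount-split (λ x → true ∷ proj₁ x , proj₂ x) (λ x → false ∷ proj₁ x , proj₂ x)
    (λ { refl → refl }) (λ { refl → refl }) (λ _ _ ()) λ where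
      (true ∷ v , y)  → inj₁ ((v , y) , refl)
      (false ∷ v , y) → inj₂ ((v , y) , refl)

  HasCount-∷ʳ : ∀ {k a b} {P : B × Vec Bool (suc k) → Set} →
    HasCount (λ x → P (proj₁ x , true ∷ proj₂ x)) a → HasCount (λ x → P (proj₁ x , false ∷ proj₂ x)) b →
    HasCount P (a + b)
  HasCount-∷ʳ = HasCount-split (λ x → proj₁ x , true ∷ proj₂ x) (λ x → proj₁ x , false ∷ proj₂ x)
    (λ { refl → refl }) (λ { refl → refl }) (λ _ _ ()) λ where
      (y , true ∷ v)  → inj₁ ((y , v) , refl)
      (y , false ∷ v) → inj₂ ((y , v) , refl)

count : ∀ {m n} → (Vec Bool m → Vec Bool n → Bool) → ℕ
count {zero}  {zero}  p = iverson (p [] [])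
count {zero}  {suc n} p = Σᵇ λ r → count λ s ρ → p s (r ∷ ρ)
count {suc m} {zero}  p = Σᵇ λ c → count λ s ρ → p (c ∷ s) ρ
count {suc m} {suc n} p = Σᵇ λ c → Σᵇ λ r → count λ s ρ → p (c ∷ s) (r ∷ ρ)

HasCount-count : ∀ {m n} (p : Vec Bool m → Vec Bool n → Bool) →
  HasCount (λ x → T (p (proj₁ x) (proj₂ x))) (count p)
HasCount-count {zero} {zero} p with p [] [] in p[]
... | true  = [ [] , [] ] , [] ∷ [] , refl , λ where
  ([] , []) → mk⇔ (λ _ → subst T (sym p[]) tt) (λ _ → here refl)
... | false = [] , [] , refl , λ where
  ([] , []) → mk⇔ (λ ()) (λ t → ⊥-elim (subst T p[] t))
HasCount-count {zero}  {suc n} p = HasCount-∷ʳ (HasCount-count _) (HasCount-count _)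
HasCount-count {suc m} {zero}  p = HasCount-∷ˡ (HasCount-count _) (HasCount-count _)
HasCount-count {suc m} {suc n} p =
  HasCount-∷ˡ (HasCount-∷ʳ (HasCount-count _) (HasCount-count _))
              (HasCount-∷ʳ (HasCount-count _) (HasCount-count _))

HasCount-count-cast : ∀ {m m′ n} (m≡m′ : m ≡ m′) (p : Vec Bool m′ → Vec Bool n → Bool) →
  HasCount (λ x → T (p (Vec.cast m≡m′ (proj₁ x)) (proj₂ x))) (count p)
HasCount-count-cast refl p = HasCount-⇔ (λ (S , R) → mk⇔
  (subst (λ S′ → T (p S′ R)) (sym (Vecₚ.cast-is-id refl S)))
  (subst (λ S′ → T (p S′ R)) (Vecₚ.cast-is-id refl S))) (HasCount-count p)

Σᵇ-≡0 : {f : Bool → ℕ} → (∀ c → f c ≡ 0) → Σᵇ f ≡ 0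
Σᵇ-≡0 f≡0 = cong₂ _+_ (f≡0 true) (f≡0 false)

count-≡0 : ∀ {m n} (p : Vec Bool m → Vec Bool n → Bool) → (∀ s ρ → p s ρ ≡ false) → count p ≡ 0
count-≡0 {zero}  {zero}  p never = cong iverson (never [] [])
count-≡0 {zero}  {suc n} p never = Σᵇ-≡0 λ r → count-≡0 _ λ s ρ → never s (r ∷ ρ)
count-≡0 {suc m} {zero}  p never = Σᵇ-≡0 λ c → count-≡0 _ λ s ρ → never (c ∷ s) ρ
count-≡0 {suc m} {suc n} p never =
  Σᵇ-≡0 λ c → Σᵇ-≡0 λ r → count-≡0 _ λ s ρ → never (c ∷ s) (r ∷ ρ)

-- Spanning rooted forests through component labels

trues : ∀ {n} → (Fin n → Bool) → ℕ
trues {zero}  q = 0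
trues {suc n} q = iverson (q zero) + trues (q ∘ suc)

trues-false : ∀ {n} → trues {n} (λ _ → false) ≡ 0
trues-false {zero}  = refl
trues-false {suc n} = trues-false {n}

trues≡0⇔ : ∀ {n} (q : Fin n → Bool) → trues q ≡ 0 ⇔ (∀ i → ¬ T (q i))
trues≡0⇔ {zero}  q = mk⇔ (λ _ ()) (λ _ → refl)
trues≡0⇔ {suc n} q with q zero in q₀
... | true  = mk⇔ (λ ()) (λ none → ⊥-elim (none zero (subst T (sym q₀) tt)))
... | false = mk⇔ (λ rest → λ { zero → subst T q₀ ; (suc i) → to (trues≡0⇔ (q ∘ suc)) rest i })
                  (λ none → from (trues≡0⇔ (q ∘ suc)) (none ∘ suc))

ExactlyOne : ∀ {n} → (Fin n → Set) → Set
ExactlyOne {n} P = Σ (Fin n) λ r → P r × (∀ r′ → P r′ → r′ ≡ r)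

trues≡1⇔ : ∀ {n} (q : Fin n → Bool) → trues q ≡ 1 ⇔ ExactlyOne (T ∘ q)
trues≡1⇔ {zero}  q = mk⇔ (λ ()) λ ()
trues≡1⇔ {suc n} q with q zero in q₀
... | true  = mk⇔ (λ rest → zero , q-zero , only-zero (to (trues≡0⇔ (q ∘ suc)) (suc-injective rest)))
                  (λ { (r , _ , unique) → cong suc (from (trues≡0⇔ (q ∘ suc))
                         λ i t → 0≢1+n (trans (unique zero q-zero) (sym (unique (suc i) t)))) })
  where
  q-zero : T (q zero)
  q-zero = subst T (sym q₀) tt
  only-zero : (∀ i → ¬ T (q (suc i))) → ∀ r′ → T (q r′) → r′ ≡ zero
  only-zero none zero    _ = refl
  only-zero none (suc i) t = ⊥-elim (none i t)
... | false = mk⇔ shift unshift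
  where
  shift : trues (q ∘ suc) ≡ 1 → ExactlyOne (T ∘ q)
  shift rest with to (trues≡1⇔ (q ∘ suc)) rest
  ... | r , t , unique = suc r , t , λ where
    zero    t′ → ⊥-elim (subst T q₀ t′)
    (suc i) t′ → cong suc (unique i t′)
  unshift : ExactlyOne (T ∘ q) → trues (q ∘ suc) ≡ 1
  unshift (zero  , t , _)      = ⊥-elim (subst T q₀ t)
  unshift (suc r , t , unique) =
    from (trues≡1⇔ (q ∘ suc)) (r , t , λ i t′ → Finₚ.suc-injective (unique (suc i) t′))

∈⇔T-lookup : ∀ {n} {R : Subset n} {r} → r ∈ R ⇔ T (lookup R r)
∈⇔T-lookup {R = R} {r} = mk⇔ (from T-≡ ∘ []=⇒lookup) (lookup⇒[]= r R ∘ to T-≡)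

rootsLabelled : ∀ {n} → (Fin n → ℕ) → Subset n → ℕ → ℕ
rootsLabelled label R ℓ = trues λ r → (ℓ ≡ᵇ label r) ∧ lookup R r

forest⇔rootsLabelled : ∀ {n} (E : List (Fin n × Fin n)) (S : EdgeSet E) (label : Fin n → ℕ) →
  Acyclic E S → (∀ u v → Connected E S u v ⇔ label u ≡ label v) →
  ∀ R → IsSpanningRootedForest E (S , R) ⇔ (∀ v → rootsLabelled label R (label v) ≡ 1)
forest⇔rootsLabelled E S label acyclic connected⇔ R =
  mk⇔ (λ (_ , rooted) v → from (trues≡1⇔ _) (one-root⇒ (rooted v)))
      (λ counts → acyclic , λ v → ⇒one-root (to (trues≡1⇔ _) (counts v)))
  where
  RootOf : Fin _ → Fin _ → Set
  RootOf v r = r ∈ R × Connected E S v r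
  OneRootOf : Fin _ → Set
  OneRootOf v = Σ (Fin _) λ r →
    r ∈ R × Connected E S v r × (∀ r′ → r′ ∈ R → Connected E S v r′ → r′ ≡ r)
  rootOf⇔ : ∀ v r → RootOf v r ⇔ T ((label v ≡ᵇ label r) ∧ lookup R r)
  rootOf⇔ v r = mk⇔
    (λ (r∈ , v~r) → from T-∧ (≡⇒≡ᵇ _ _ (to (connected⇔ v r) v~r) , to ∈⇔T-lookup r∈))
    (λ t → from ∈⇔T-lookup (proj₂ (to T-∧ t)) , from (connected⇔ v r) (≡ᵇ⇒≡ _ _ (proj₁ (to T-∧ t))))
  one-root⇒ : ∀ {v} → OneRootOf v → ExactlyOne λ r → T ((label v ≡ᵇ label r) ∧ lookup R r)
  one-root⇒ {v} (r , r∈ , v~r , unique) = r , to (rootOf⇔ v r) (r∈ , v~r) , λ r′ t →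
    let (r′∈ , v~r′) = from (rootOf⇔ v r′) t in unique r′ r′∈ v~r′
  ⇒one-root : ∀ {v} → ExactlyOne (λ r → T ((label v ≡ᵇ label r) ∧ lookup R r)) → OneRootOf v
  ⇒one-root {v} (r , t , unique) = let (r∈ , v~r) = from (rootOf⇔ v r) t in
    r , r∈ , v~r , λ r′ r′∈ v~r′ → unique r′ (to (rootOf⇔ v r′) (r′∈ , v~r′))

module _ {n} {E : List (Fin n × Fin n)} {S : EdgeSet E} where

  Adj-sym : ∀ {u v} → Adj E S u v → Adj E S v u
  Adj-sym (e , e∈ , uv) = e , e∈ , swap uv

  Connected-isEquivalence : IsEquivalence (Connected E S)
  Connected-isEquivalence = record { refl = ε ; sym = reverse Adj-sym ; trans = _◅◅_ }

-- Graphs whose edges join vertices to their parents are acyclic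

module _ {V : Set} where

  second : List V → V → V
  second []      y = y
  second (z ∷ _) _ = z

  penultimate : V → List V → V
  penultimate x []       = x
  penultimate x (z ∷ zs) = penultimate z zs

  penultimate∈ : ∀ x zs → penultimate x zs ∈ₗ x ∷ zs
  penultimate∈ x []       = here refl
  penultimate∈ x (z ∷ zs) = there (penultimate∈ z zs)

  NonBacktracking : List V → Set
  NonBacktracking (x ∷ y ∷ z ∷ ws) = x ≢ z × NonBacktracking (y ∷ z ∷ ws)
  NonBacktracking _                = ⊤

  nonBacktracking-tail : ∀ {x z y} zs → NonBacktracking (x ∷ z ∷ zs ++ [ y ]) →
    x ≢ second zs y × NonBacktracking (z ∷ zs ++ [ y ])
  nonBacktracking-tail []      (x≢y , _) = x≢y , _
  nonBacktracking-tail (_ ∷ _) nb        = nb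

  unique⇒nonBacktracking : ∀ {v} ws → Unique ws → All (v ≢_) ws → NonBacktracking (ws ++ [ v ])
  unique⇒nonBacktracking []               _                      _              = _
  unique⇒nonBacktracking (_ ∷ [])         _                      _              = _
  unique⇒nonBacktracking (_ ∷ _ ∷ [])     _                      (v≢a ∷ _ ∷ []) = v≢a ∘ sym , _
  unique⇒nonBacktracking (_ ∷ b ∷ c ∷ ws) ((_ ∷ a≢c ∷ _) ∷ bcws!) (_ ∷ v∉bcws)  =
    a≢c , unique⇒nonBacktracking (b ∷ c ∷ ws) bcws! v∉bcws

module ParentOrientation {n} (parent : Fin n → Fin n) (depth : Fin n → ℕ) where

  _⋖_ : Fin n → Fin n → Set
  u ⋖ v = u ≡ parent v × depth u < depth v

  module _ {E : List (Fin n × Fin n)} (edges-to-parents : ∀ {u v} → (u , v) ∈ₗ E → u ⋖ v ⊎ v ⋖ u)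
           {S : EdgeSet E} where

    adj-to-parent : ∀ {u v} → Adj E S u v → u ⋖ v ⊎ v ⋖ u
    adj-to-parent (e , _ , inj₁ uv) = edges-to-parents (subst (_∈ₗ E) uv (∈-lookup e))
    adj-to-parent (e , _ , inj₂ vu) = swap (edges-to-parents (subst (_∈ₗ E) vu (∈-lookup e)))

    -- Once a non-backtracking walk steps down to a child it can never climb again: the only
    -- step up from a vertex leads back to its parent.
    walk-shape : ∀ x zs y → Chain E S (x ∷ zs ++ [ y ]) → NonBacktracking (x ∷ zs ++ [ y ]) →
      (depth x < depth y × penultimate x zs ⋖ y) ⊎
      (second zs y ⋖ x × (depth y < depth x ⊎ penultimate x zs ⋖ y))
    walk-shape x [] y (x~y , _) _ with adj-to-parent x~y
    ... | inj₁ x⋖y = inj₁ (proj₂ x⋖y , x⋖y)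
    ... | inj₂ y⋖x = inj₂ (y⋖x , inj₁ (proj₂ y⋖x))
    walk-shape x (z ∷ zs) y (x~z , walk) nb with nonBacktracking-tail zs nb
    ... | x≢w , nb′ with adj-to-parent x~z | walk-shape z zs y walk nb′
    ... | inj₁ x⋖z | inj₁ (z<y , last)    = inj₁ (<-trans (proj₂ x⋖z) z<y , last)
    ... | inj₁ x⋖z | inj₂ (w⋖z , _)      = ⊥-elim (x≢w (trans (proj₁ x⋖z) (sym (proj₁ w⋖z))))
    ... | inj₂ z⋖x | inj₁ (_ , last)      = inj₂ (z⋖x , inj₂ last)
    ... | inj₂ z⋖x | inj₂ (_ , inj₁ y<z)  = inj₂ (z⋖x , inj₁ (<-trans y<z (proj₂ z⋖x)))
    ... | inj₂ z⋖x | inj₂ (_ , inj₂ last) = inj₂ (z⋖x , inj₂ last)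

    -- A cycle through v would have to leave v upwards and re-enter it from above, so its second
    -- and its penultimate vertex would both be the parent of v.
    acyclic : Acyclic E S
    acyclic (_ , []     , ()     , _)
    acyclic (_ , _ ∷ [] , s≤s () , _)
    acyclic (v , a ∷ b ∷ ws , _ , (v∉ ∷ a∉ ∷ bws!) , cycle)
      with walk-shape v (a ∷ b ∷ ws) v cycle
             (All.lookup v∉ (there (here refl)) , unique⇒nonBacktracking (a ∷ b ∷ ws) (a∉ ∷ bws!) v∉)
    ... | inj₁ (v<v , _)           = <-irrefl refl v<v
    ... | inj₂ (_ , inj₁ v<v)      = <-irrefl refl v<v
    ... | inj₂ (a⋖v , inj₂ last⋖v) =
      All.lookup a∉ (penultimate∈ b ws) (trans (proj₁ a⋖v) (sym (proj₁ last⋖v)))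

-- Rooted forests of a path

segment : ∀ {k} → Vec Bool k → Fin (suc k) → ℕ
segment s       zero    = 0
segment (c ∷ s) (suc j) = iverson (not c) + segment s j

segment-edge : ∀ {k} (s : Vec Bool k) c → lookup s c ≡ true → segment s (inject₁ c) ≡ segment s (suc c)
segment-edge (true ∷ s) zero    refl = refl
segment-edge (x ∷ s)    (suc c) on   = cong (iverson (not x) +_) (segment-edge s c on)

PathEdgesRelated : ∀ {k} → Vec Bool k → Rel (Fin (suc k)) 0ℓ → Set
PathEdgesRelated s _~_ = ∀ c → lookup s c ≡ true → inject₁ c ~ suc c

segment-connected₀ : ∀ {k} (s : Vec Bool k) {_~_ : Rel (Fin (suc k)) 0ℓ} → IsEquivalence _~_ →
  PathEdgesRelated s _~_ → ∀ j → 0 ≡ segment s j → zero ~ j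
segment-connected₀ s          ~-equiv edge zero    _    = IsEquivalence.refl ~-equiv
segment-connected₀ (true ∷ s) ~-equiv edge (suc j) same =
  IsEquivalence.trans ~-equiv (edge zero refl)
    (segment-connected₀ s (On.isEquivalence suc ~-equiv) (edge ∘ suc) j same)

segment-connected : ∀ {k} (s : Vec Bool k) {_~_ : Rel (Fin (suc k)) 0ℓ} → IsEquivalence _~_ →
  PathEdgesRelated s _~_ → ∀ i j → segment s i ≡ segment s j → i ~ j
segment-connected s       ~-equiv edge zero    j       same = segment-connected₀ s ~-equiv edge j same
segment-connected s       ~-equiv edge (suc i) zero    same =
  IsEquivalence.sym ~-equiv (segment-connected₀ s ~-equiv edge (suc i) (sym same))
segment-connected (c ∷ s) ~-equiv edge (suc i) (suc j) same =
  segment-connected s (On.isEquivalence suc ~-equiv) (edge ∘ suc) i j (+-cancelˡ-≡ (iverson (not c)) _ _ same)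

rootsInSegment : ∀ {k} → ℕ → Vec Bool k → Vec Bool (suc k) → ℕ → ℕ
rootsInSegment e s ρ zero    = e + trues (λ j → (0 ≡ᵇ segment s j) ∧ lookup ρ j)
rootsInSegment e s ρ (suc t) = trues (λ j → (suc t ≡ᵇ segment s j) ∧ lookup ρ j)

PathRooted : ∀ {k} → ℕ → Vec Bool k → Vec Bool (suc k) → Set
PathRooted e s ρ = ∀ j → rootsInSegment e s ρ (segment s j) ≡ 1

rootsInSegment-0 : ∀ {k} (s : Vec Bool k) ρ t →
  rootsInSegment 0 s ρ t ≡ trues (λ j → (t ≡ᵇ segment s j) ∧ lookup ρ j)
rootsInSegment-0 s ρ zero    = refl
rootsInSegment-0 s ρ (suc t) = refl

rootsInSegment-joined : ∀ {k} e (s : Vec Bool k) r ρ t →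
  rootsInSegment e (true ∷ s) (r ∷ ρ) t ≡ rootsInSegment (iverson r + e) s ρ t
rootsInSegment-joined e s r ρ zero    =
  trans (x∙yz≈y∙xz +-commutativeSemigroup e (iverson r) _) (sym (+-assoc (iverson r) e _))
rootsInSegment-joined e s r ρ (suc t) = refl

rootsInSegment-cut₀ : ∀ {k} e (s : Vec Bool k) r ρ → rootsInSegment e (false ∷ s) (r ∷ ρ) 0 ≡ iverson r + e
rootsInSegment-cut₀ {k} e s r ρ = begin
  e + (iverson r + trues {suc k} (λ _ → false)) ≡⟨ cong (λ z → e + (iverson r + z)) (trues-false {suc k}) ⟩
  e + (iverson r + 0)                           ≡⟨ cong (e +_) (+-identityʳ (iverson r)) ⟩
  e + iverson r                                 ≡⟨ +-comm e (iverson r) ⟩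
  iverson r + e                                 ∎
  where open ≡-Reasoning

rootsInSegment-cut : ∀ {k} e (s : Vec Bool k) r ρ t →
  rootsInSegment e (false ∷ s) (r ∷ ρ) (suc t) ≡ rootsInSegment 0 s ρ t
rootsInSegment-cut e s r ρ t = sym (rootsInSegment-0 s ρ t)

Checker : ℕ → ℕ → Set
Checker m n = ℕ → Vec Bool m → Vec Bool n → Bool

-- s: which of the k path edges are present; ρ: which of the k + 1 path vertices are roots;
-- e: roots already known to lie in the component of the first vertex (coming from leaves);
-- t: an extra condition on the root bit of the last vertex.
pathForestᵇ : ∀ {k} → (Bool → Bool) → Checker k (suc k)
pathForestᵇ t e []          (r ∷ []) = (iverson r + e ≡ᵇ 1) ∧ t r
pathForestᵇ t e (true ∷ s)  (r ∷ ρ)  = pathForestᵇ t (iverson r + e) s ρ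
pathForestᵇ t e (false ∷ s) (r ∷ ρ)  = (iverson r + e ≡ᵇ 1) ∧ pathForestᵇ t 0 s ρ

≡⇔≡ᵇ : ∀ {m n} → m ≡ n ⇔ T (m ≡ᵇ n)
≡⇔≡ᵇ = mk⇔ (≡⇒≡ᵇ _ _) (≡ᵇ⇒≡ _ _)

pathRooted⇔ : ∀ {k} e (s : Vec Bool k) ρ → PathRooted e s ρ ⇔ T (pathForestᵇ (λ _ → true) e s ρ)
pathRooted⇔ e [] (r ∷ []) = mk⇔
  (λ rooted → from T-∧ (to ≡⇔≡ᵇ (trans (sym single) (rooted zero)) , tt))
  (λ t → λ { zero → trans single (from ≡⇔≡ᵇ (proj₁ (to T-∧ t))) })
  where
  single : e + (iverson r + 0) ≡ iverson r + e
  single = trans (cong (e +_) (+-identityʳ (iverson r))) (+-comm e (iverson r))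
pathRooted⇔ e (true ∷ s) (r ∷ ρ) = pathRooted⇔ (iverson r + e) s ρ ⇔-∘ mk⇔
  (λ rooted j → trans (sym (rootsInSegment-joined e s r ρ (segment s j))) (rooted (suc j)))
  (λ rooted → λ { zero    → trans (rootsInSegment-joined e s r ρ 0) (rooted zero)
                ; (suc j) → trans (rootsInSegment-joined e s r ρ (segment s j)) (rooted j) })
pathRooted⇔ e (false ∷ s) (r ∷ ρ) = ⇔-sym T-∧ ⇔-∘ ((≡⇔≡ᵇ ×-⇔ pathRooted⇔ 0 s ρ) ⇔-∘ mk⇔
  (λ rooted → trans (sym (rootsInSegment-cut₀ e s r ρ)) (rooted zero) ,
              λ j → trans (sym (rootsInSegment-cut e s r ρ (segment s j))) (rooted (suc j)))
  (λ (first , rest) → λ { zero    → trans (rootsInSegment-cut₀ e s r ρ) first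
                        ; (suc j) → trans (rootsInSegment-cut e s r ρ (segment s j)) (rest j) }))

pathForestᵇ-overfull : ∀ {k} t e (s : Vec Bool k) ρ → pathForestᵇ t (2 + e) s ρ ≡ false
pathForestᵇ-overfull t e []          (true ∷ [])  = refl
pathForestᵇ-overfull t e []          (false ∷ []) = refl
pathForestᵇ-overfull t e (true ∷ s)  (true ∷ ρ)   = pathForestᵇ-overfull t (suc e) s ρ
pathForestᵇ-overfull t e (true ∷ s)  (false ∷ ρ)  = pathForestᵇ-overfull t e s ρ
pathForestᵇ-overfull t e (false ∷ s) (true ∷ ρ)   = refl
pathForestᵇ-overfull t e (false ∷ s) (false ∷ ρ)  = refl

pathForestᵇ-last : ∀ {k} t e (s : Vec Bool k) ρ →
  pathForestᵇ t e s ρ ≡ pathForestᵇ (λ _ → true) e s ρ ∧ t (lookup ρ (fromℕ k))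
pathForestᵇ-last t e []          (r ∷ []) = cong (_∧ t r) (sym (∧-identityʳ _))
pathForestᵇ-last t e (true ∷ s)  (r ∷ ρ)  = pathForestᵇ-last t _ s ρ
pathForestᵇ-last t e (false ∷ s) (r ∷ ρ)  =
  trans (cong (_ ∧_) (pathForestᵇ-last t 0 s ρ)) (sym (∧-assoc (iverson r + e ≡ᵇ 1) _ _))

pathForest-step : ∀ {k} t n →
  count (pathForestᵇ {k} t 1) ≡ fib n → count (pathForestᵇ {k} t 0) ≡ fib (suc n) →
  count (pathForestᵇ {suc k} t 1) ≡ fib (2 + n) × count (pathForestᵇ {suc k} t 0) ≡ fib (3 + n)
pathForest-step {k} t n c₁ c₀ = count₁ , count₀
  where
  open ≡-Reasoning
  c : ℕ → ℕ
  c e = count (pathForestᵇ {k} t e)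
  none : ℕ
  none = count {k} {suc k} λ _ _ → false
  none≡0 : none ≡ 0
  none≡0 = count-≡0 {k} _ λ _ _ → refl
  count₁ : (c 2 + c 1) + (none + c 0) ≡ fib (2 + n)
  count₁ = begin
    (c 2 + c 1) + (none + c 0)
      ≡⟨ cong₂ _+_ (cong₂ _+_ (count-≡0 {k} _ (pathForestᵇ-overfull t 0)) c₁) (cong₂ _+_ none≡0 c₀) ⟩
    fib n + fib (suc n)
      ≡⟨ +-comm (fib n) _ ⟩
    fib (2 + n) ∎
  count₀ : (c 1 + c 0) + (c 0 + none) ≡ fib (3 + n)
  count₀ = begin
    (c 1 + c 0) + (c 0 + none)
      ≡⟨ cong₂ _+_ (cong₂ _+_ c₁ c₀) (cong₂ _+_ c₀ none≡0) ⟩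
    (fib n + fib (suc n)) + (fib (suc n) + 0)
      ≡⟨ cong₂ _+_ (+-comm (fib n) _) (+-identityʳ _) ⟩
    fib (3 + n) ∎

pathForest-count : ∀ t m → count (pathForestᵇ {0} t 1) ≡ fib m → count (pathForestᵇ {0} t 0) ≡ fib (suc m) →
  ∀ k → count (pathForestᵇ {k} t 1) ≡ fib (2 * k + m) × count (pathForestᵇ {k} t 0) ≡ fib (2 * k + suc m)
pathForest-count t m c₁ c₀ zero    = c₁ , c₀
pathForest-count t m c₁ c₀ (suc k) with pathForest-count t m c₁ c₀ k
... | d₁ , d₀ with pathForest-step {k} t (2 * k + m) d₁ (trans d₀ (cong fib (+-suc (2 * k) m)))
... | e₁ , e₀ = trans e₁ (cong fib (sym (cong (_+ m) (*-suc 2 k)))) ,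
                trans e₀ (cong fib (sym (trans (cong (_+ suc m) (*-suc 2 k)) (cong (2 +_) (+-suc (2 * k) m)))))

rootedFirstᵇ : ∀ {k} → Checker k (suc k)
rootedFirstᵇ e s ρ = lookup ρ zero ∧ pathForestᵇ (λ _ → true) e s ρ

rootedFirstᵇ-occupied : ∀ {k} e (s : Vec Bool k) ρ → rootedFirstᵇ (suc e) s ρ ≡ false
rootedFirstᵇ-occupied e s           (false ∷ ρ) = refl
rootedFirstᵇ-occupied e []          (true ∷ []) = refl
rootedFirstᵇ-occupied e (true ∷ s)  (true ∷ ρ)  = pathForestᵇ-overfull _ e s ρ
rootedFirstᵇ-occupied e (false ∷ s) (true ∷ ρ)  = refl

count-rootedFirst : ∀ k → count (rootedFirstᵇ {k} 0) ≡ fib (2 * k + 1)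
count-rootedFirst zero    = refl
count-rootedFirst (suc k) with pathForest-count (λ _ → true) 1 refl refl k
... | c₁ , c₀ = begin
  (c 1 + none) + (c 0 + none)
    ≡⟨ cong₂ _+_ (cong₂ _+_ c₁ none≡0) (cong₂ _+_ (trans c₀ (cong fib (+-suc (2 * k) 1))) none≡0) ⟩
  (fib (2 * k + 1) + 0) + (fib (suc (2 * k + 1)) + 0)
    ≡⟨ cong₂ _+_ (+-identityʳ (fib (2 * k + 1))) (+-identityʳ (fib (suc (2 * k + 1)))) ⟩
  fib (2 * k + 1) + fib (suc (2 * k + 1))
    ≡⟨ +-comm (fib (2 * k + 1)) _ ⟩
  fib (2 + (2 * k + 1))
    ≡⟨ cong fib (cong (_+ 1) (sym (*-suc 2 k))) ⟩
  fib (2 * suc k + 1) ∎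
  where
  open ≡-Reasoning
  c : ℕ → ℕ
  c e = count (pathForestᵇ {k} (λ _ → true) e)
  none : ℕ
  none = count {k} {suc k} λ _ _ → false
  none≡0 : none ≡ 0
  none≡0 = count-≡0 {k} _ λ _ _ → refl

-- Pendant leaves

-- A leaf with edge bit x and root bit r hanging at the first vertex: when detached it has to be
-- a root, and when attached and rooted it puts one more root into the component counted by e.
withLeafᵇ : ∀ {m n} → Checker m n → Checker (suc m) (suc n)
withLeafᵇ Q e (x ∷ S) (r ∷ R) = (x ∨ r) ∧ Q (iverson (x ∧ r) + e) S R

count-withLeaf : ∀ {m n} (Q : Checker m n) e →
  count (withLeafᵇ Q e) ≡ count (Q (suc e)) + 2 * count (Q e)
count-withLeaf {m} {n} Q e = begin
  (count (Q (suc e)) + count (Q e)) + (count (Q e) + count {m} {n} λ _ _ → false)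
    ≡⟨ cong (λ z → (count (Q (suc e)) + count (Q e)) + (count (Q e) + z)) (count-≡0 {m} {n} _ λ _ _ → refl) ⟩
  (count (Q (suc e)) + count (Q e)) + (count (Q e) + 0)
    ≡⟨ +-assoc (count (Q (suc e))) _ _ ⟩
  count (Q (suc e)) + 2 * count (Q e) ∎
  where open ≡-Reasoning

caterpillarᵇ : ∀ {m n} → Checker m n → Vec Bool (2 + m) → Vec Bool (2 + n) → Bool
caterpillarᵇ Q = withLeafᵇ (withLeafᵇ Q) 0

count-caterpillar : ∀ {m n} (Q : Checker m n) → count (Q 2) ≡ 0 →
  count (caterpillarᵇ Q) ≡ 4 * (count (Q 0) + count (Q 1))
count-caterpillar Q Q₂≡0 = begin
  count (withLeafᵇ (withLeafᵇ Q) 0)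
    ≡⟨ count-withLeaf (withLeafᵇ Q) 0 ⟩
  count (withLeafᵇ Q 1) + 2 * count (withLeafᵇ Q 0)
    ≡⟨ cong₂ (λ x y → x + 2 * y) (count-withLeaf Q 1) (count-withLeaf Q 0) ⟩
  (count (Q 2) + 2 * count (Q 1)) + 2 * (count (Q 1) + 2 * count (Q 0))
    ≡⟨ cong (λ z → (z + 2 * count (Q 1)) + 2 * (count (Q 1) + 2 * count (Q 0))) Q₂≡0 ⟩
  (0 + 2 * count (Q 1)) + 2 * (count (Q 1) + 2 * count (Q 0))
    ≡⟨ arithmetic (count (Q 0)) (count (Q 1)) ⟩
  4 * (count (Q 0) + count (Q 1)) ∎
  where
  open ≡-Reasoning
  arithmetic : ∀ a b → (0 + 2 * b) + 2 * (b + 2 * a) ≡ 4 * (a + b)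
  arithmetic = solve-∀

caterpillarᵇ-∧ : ∀ {m n} {Q Q′ : Checker m n} {f : Vec Bool n → Bool} →
  (∀ e s ρ → Q′ e s ρ ≡ Q e s ρ ∧ f ρ) →
  ∀ S r₀ r₁ ρ → caterpillarᵇ Q′ S (r₀ ∷ r₁ ∷ ρ) ≡ caterpillarᵇ Q S (r₀ ∷ r₁ ∷ ρ) ∧ f ρ
caterpillarᵇ-∧ {Q = Q} {Q′} {f} Q′≡ (a ∷ b ∷ s) r₀ r₁ ρ = begin
  (a ∨ r₀) ∧ ((b ∨ r₁) ∧ Q′ e s ρ)        ≡⟨ cong (λ z → (a ∨ r₀) ∧ ((b ∨ r₁) ∧ z)) (Q′≡ e s ρ) ⟩
  (a ∨ r₀) ∧ ((b ∨ r₁) ∧ (Q e s ρ ∧ f ρ)) ≡⟨ cong ((a ∨ r₀) ∧_) (∧-assoc (b ∨ r₁) _ _) ⟨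
  (a ∨ r₀) ∧ (((b ∨ r₁) ∧ Q e s ρ) ∧ f ρ) ≡⟨ ∧-assoc (a ∨ r₀) _ _ ⟨
  ((a ∨ r₀) ∧ ((b ∨ r₁) ∧ Q e s ρ)) ∧ f ρ ∎
  where
  open ≡-Reasoning
  e : ℕ
  e = iverson (b ∧ r₁) + (iverson (a ∧ r₀) + 0)

fib-+2 : ∀ n m → fib (n + suc (suc m)) ≡ fib (n + suc m) + fib (n + m)
fib-+2 n m rewrite +-suc n (suc m) | +-suc n m = refl

count-caterpillar-forests : ∀ k → count (caterpillarᵇ (pathForestᵇ {k} (λ _ → true))) ≡ 4 * fib (2 * k + 3)
count-caterpillar-forests k with pathForest-count (λ _ → true) 1 refl refl k
... | c₁ , c₀ = begin
  count (caterpillarᵇ (pathForestᵇ {k} (λ _ → true)))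
    ≡⟨ count-caterpillar (pathForestᵇ {k} (λ _ → true)) (count-≡0 {k} _ (pathForestᵇ-overfull _ 0)) ⟩
  4 * (count (pathForestᵇ {k} (λ _ → true) 0) + count (pathForestᵇ {k} (λ _ → true) 1))
    ≡⟨ cong (4 *_) (trans (cong₂ _+_ c₀ c₁) (sym (fib-+2 (2 * k) 1))) ⟩
  4 * fib (2 * k + 3) ∎
  where open ≡-Reasoning

count-caterpillar-rootedFirst : ∀ k → count (caterpillarᵇ (rootedFirstᵇ {k})) ≡ 4 * fib (2 * k + 1)
count-caterpillar-rootedFirst k = begin
  count (caterpillarᵇ (rootedFirstᵇ {k}))
    ≡⟨ count-caterpillar (rootedFirstᵇ {k}) (count-≡0 {k} _ (rootedFirstᵇ-occupied 1)) ⟩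
  4 * (count (rootedFirstᵇ {k} 0) + count (rootedFirstᵇ {k} 1))
    ≡⟨ cong (4 *_) (cong₂ _+_ (count-rootedFirst k) (count-≡0 {k} _ (rootedFirstᵇ-occupied 0))) ⟩
  4 * (fib (2 * k + 1) + 0)
    ≡⟨ cong (4 *_) (+-identityʳ (fib (2 * k + 1))) ⟩
  4 * fib (2 * k + 1) ∎
  where open ≡-Reasoning

count-caterpillar-rootedLast : ∀ k → count (caterpillarᵇ (pathForestᵇ {k} id)) ≡ 4 * fib (2 * k + 2)
count-caterpillar-rootedLast k with pathForest-count id 0 refl refl k
... | c₁ , c₀ = begin
  count (caterpillarᵇ (pathForestᵇ {k} id))
    ≡⟨ count-caterpillar (pathForestᵇ {k} id) (count-≡0 {k} _ (pathForestᵇ-overfull _ 0)) ⟩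
  4 * (count (pathForestᵇ {k} id 0) + count (pathForestᵇ {k} id 1))
    ≡⟨ cong (4 *_) (trans (cong₂ _+_ c₀ c₁) (sym (fib-+2 (2 * k) 0))) ⟩
  4 * fib (2 * k + 2) ∎
  where open ≡-Reasoning

iverson≡1⇔T : ∀ r → iverson r ≡ 1 ⇔ T r
iverson≡1⇔T true  = mk⇔ _ λ _ → refl
iverson≡1⇔T false = mk⇔ (λ ()) λ ()

≡1-cong : ∀ {m n} → m ≡ n → m ≡ 1 ⇔ n ≡ 1
≡1-cong m≡n = mk⇔ (trans (sym m≡n)) (trans m≡n)

-- The T-caterpillar

module Caterpillar (k : ℕ) where

  pathEdge : Fin k → Fin (3 + k) × Fin (3 + k)
  pathEdge j = 2 ↑ʳ inject₁ j , 2 ↑ʳ suc j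

  length-pathEdges : length (tabulate pathEdge) ≡ k
  length-pathEdges = length-tabulate pathEdge

  lookup-pathEdges : ∀ i → List.lookup (tabulate pathEdge) i ≡ pathEdge (Fin.cast length-pathEdges i)
  lookup-pathEdges i = begin
    List.lookup (tabulate pathEdge) i
      ≡⟨ cong (List.lookup (tabulate pathEdge)) (sym (Finₚ.cast-involutive _ length-pathEdges i)) ⟩
    List.lookup (tabulate pathEdge) (Fin.cast (sym length-pathEdges) (Fin.cast length-pathEdges i))
      ≡⟨ lookup-tabulate pathEdge (Fin.cast length-pathEdges i) ⟩
    pathEdge (Fin.cast length-pathEdges i) ∎
    where open ≡-Reasoning

  pathVertex : Fin (suc k) → Fin (3 + k)
  pathVertex j = suc (suc j)

  -- T_n rooted at vertex 3.
  parent : Fin (3 + k) → Fin (3 + k)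
  parent (suc (suc (suc j))) = suc (suc (inject₁ j))
  parent _                   = suc (suc zero)

  depth : Fin (3 + k) → ℕ
  depth (suc (suc j)) = toℕ j
  depth _             = 1

  open ParentOrientation parent depth using (_⋖_; acyclic)

  edges-to-parents : ∀ {u v} → (u , v) ∈ₗ T-edges k → u ⋖ v ⊎ v ⋖ u
  edges-to-parents (here refl)         = inj₂ (refl , s≤s z≤n)
  edges-to-parents (there (here refl)) = inj₂ (refl , s≤s z≤n)
  edges-to-parents (there (there uv∈)) with ∈-tabulate⁻ uv∈
  ... | j , refl = inj₁ (refl , s≤s (≤-reflexive (toℕ-inject₁ j)))

  -- A detached leaf is labelled by its own index 0 or 1; every other vertex is labelled by
  -- 2 + the segment of the path it is joined to.
  leafLabel : Bool → Fin 2 → ℕ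
  leafLabel true  _ = 2
  leafLabel false i = toℕ i

  label : Bool → Bool → Vec Bool k → Fin (3 + k) → ℕ
  label a b s zero          = leafLabel a zero
  label a b s (suc zero)    = leafLabel b (suc zero)
  label a b s (suc (suc j)) = 2 + segment s j

  module _ {S′ : Vec Bool (length (tabulate pathEdge))} where

    private
      s : Vec Bool k
      s = Vec.cast length-pathEdges S′

    pathEdge-label : ∀ {a b} i → lookup S′ i ≡ true →
      ∀ {u v} → pathEdge (Fin.cast length-pathEdges i) ≡ (u , v) → label a b s u ≡ label a b s v
    pathEdge-label i on refl =
      cong (2 +_) (segment-edge s (Fin.cast length-pathEdges i) (trans (Vecₚ.lookup-cast length-pathEdges S′ i) on))

    adj⇒label≡ : ∀ {a b u v} → Adj (T-edges k) (a ∷ b ∷ S′) u v → label a b s u ≡ label a b s v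
    adj⇒label≡ (zero , here , inj₁ refl)           = refl
    adj⇒label≡ (zero , here , inj₂ refl)           = refl
    adj⇒label≡ (suc zero , there here , inj₁ refl) = refl
    adj⇒label≡ (suc zero , there here , inj₂ refl) = refl
    adj⇒label≡ (suc (suc i) , there (there i∈) , inj₁ uv) =
      pathEdge-label i ([]=⇒lookup i∈) (trans (sym (lookup-pathEdges i)) uv)
    adj⇒label≡ (suc (suc i) , there (there i∈) , inj₂ vu) =
      sym (pathEdge-label i ([]=⇒lookup i∈) (trans (sym (lookup-pathEdges i)) vu))

    connected⇒label≡ : ∀ {a b u v} → Connected (T-edges k) (a ∷ b ∷ S′) u v → label a b s u ≡ label a b s v
    connected⇒label≡ ε            = refl
    connected⇒label≡ (u~w ◅ w~*v) = trans (adj⇒label≡ u~w) (connected⇒label≡ w~*v)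

    path-connected : ∀ {a b} i j → segment s i ≡ segment s j →
      Connected (T-edges k) (a ∷ b ∷ S′) (pathVertex i) (pathVertex j)
    path-connected = segment-connected s (On.isEquivalence pathVertex Connected-isEquivalence) λ c on →
      (suc (suc (Fin.cast (sym length-pathEdges) c)) ,
       there (there (lookup⇒[]= _ S′ (trans (sym (Vecₚ.lookup-cast₁ length-pathEdges S′ c)) on))) ,
       inj₁ (lookup-tabulate pathEdge c)) ◅ ε

    Isolated : Bool → Bool → Fin (3 + k) → Set
    Isolated a b v = ∀ u → label a b s u ≡ label a b s v → u ≡ v

    OnPath : Bool → Bool → Fin (3 + k) → Set
    OnPath a b v = Σ (Fin (suc k)) λ j →
      Connected (T-edges k) (a ∷ b ∷ S′) v (pathVertex j) × label a b s v ≡ 2 + segment s j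

    isolated-or-onPath : ∀ a b v → Isolated a b v ⊎ OnPath a b v
    isolated-or-onPath a     b     (suc (suc j)) = inj₂ (j , ε , refl)
    isolated-or-onPath true  b     zero          = inj₂ (zero , (zero , here , inj₁ refl) ◅ ε , refl)
    isolated-or-onPath a     true  (suc zero)    = inj₂ (zero , (suc zero , there here , inj₁ refl) ◅ ε , refl)
    isolated-or-onPath false true  zero          = inj₁ λ { zero _ → refl ; (suc zero) () ; (suc (suc _)) () }
    isolated-or-onPath false false zero          = inj₁ λ { zero _ → refl ; (suc zero) () ; (suc (suc _)) () }
    isolated-or-onPath true  false (suc zero)    = inj₁ λ { zero () ; (suc zero) _ → refl ; (suc (suc _)) () }
    isolated-or-onPath false false (suc zero)    = inj₁ λ { zero () ; (suc zero) _ → refl ; (suc (suc _)) () }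

    label≡⇒connected : ∀ {a b} u v → label a b s u ≡ label a b s v → Connected (T-edges k) (a ∷ b ∷ S′) u v
    label≡⇒connected {a} {b} u v same with isolated-or-onPath a b u | isolated-or-onPath a b v
    ... | inj₁ u-alone | _ = subst (Connected (T-edges k) (a ∷ b ∷ S′) u) (sym (u-alone v (sym same))) ε
    ... | _ | inj₁ v-alone = subst (λ w → Connected (T-edges k) (a ∷ b ∷ S′) w v) (sym (v-alone u same)) ε
    ... | inj₂ (i , u~i , ℓu) | inj₂ (j , v~j , ℓv) =
      u~i ◅◅ path-connected i j (suc-injective (suc-injective (trans (sym ℓu) (trans same ℓv))))
          ◅◅ reverse Adj-sym v~j

    connected⇔label≡ : ∀ {a b} u v → Connected (T-edges k) (a ∷ b ∷ S′) u v ⇔ label a b s u ≡ label a b s v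
    connected⇔label≡ u v = mk⇔ connected⇒label≡ (label≡⇒connected u v)

    leafRoots : Bool → Bool → Bool → Bool → ℕ
    leafRoots a b r₀ r₁ = iverson (b ∧ r₁) + (iverson (a ∧ r₀) + 0)

    leaf-rootsInSegment : ∀ x r i e ρ t →
      iverson ((2 + t ≡ᵇ leafLabel x i) ∧ r) + rootsInSegment e s ρ t ≡ rootsInSegment (iverson (x ∧ r) + e) s ρ t
    leaf-rootsInSegment true  r i          e ρ zero    = sym (+-assoc (iverson r) e _)
    leaf-rootsInSegment true  r i          e ρ (suc t) = refl
    leaf-rootsInSegment false r zero       e ρ t       = refl
    leaf-rootsInSegment false r (suc zero) e ρ t       = refl

    roots-on-path : ∀ a b r₀ r₁ ρ t →
      rootsLabelled (label a b s) (r₀ ∷ r₁ ∷ ρ) (2 + t) ≡ rootsInSegment (leafRoots a b r₀ r₁) s ρ t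
    roots-on-path a b r₀ r₁ ρ t = begin
      ℓ₀ + (ℓ₁ + trues (λ j → (t ≡ᵇ segment s j) ∧ lookup ρ j))
        ≡⟨ cong (λ z → ℓ₀ + (ℓ₁ + z)) (sym (rootsInSegment-0 s ρ t)) ⟩
      ℓ₀ + (ℓ₁ + rootsInSegment 0 s ρ t)
        ≡⟨ cong (ℓ₀ +_) (leaf-rootsInSegment b r₁ (suc zero) 0 ρ t) ⟩
      ℓ₀ + rootsInSegment (iverson (b ∧ r₁) + 0) s ρ t
        ≡⟨ leaf-rootsInSegment a r₀ zero _ ρ t ⟩
      rootsInSegment (iverson (a ∧ r₀) + (iverson (b ∧ r₁) + 0)) s ρ t
        ≡⟨ cong (λ e → rootsInSegment e s ρ t) (x∙yz≈y∙xz +-commutativeSemigroup (iverson (a ∧ r₀)) _ 0) ⟩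
      rootsInSegment (leafRoots a b r₀ r₁) s ρ t ∎
      where
      open ≡-Reasoning
      ℓ₀ ℓ₁ : ℕ
      ℓ₀ = iverson ((2 + t ≡ᵇ leafLabel a zero) ∧ r₀)
      ℓ₁ = iverson ((2 + t ≡ᵇ leafLabel b (suc zero)) ∧ r₁)

    isolated-roots : ∀ r → iverson r + trues {suc k} (λ _ → false) ≡ iverson r
    isolated-roots r = trans (cong (iverson r +_) (trues-false {suc k})) (+-identityʳ (iverson r))

    leaf₀-rooted⇔ : ∀ a b r₀ r₁ ρ → PathRooted (leafRoots a b r₀ r₁) s ρ →
      rootsLabelled (label a b s) (r₀ ∷ r₁ ∷ ρ) (label a b s zero) ≡ 1 ⇔ T (a ∨ r₀)
    leaf₀-rooted⇔ true  b     r₀ r₁ ρ rooted = mk⇔ _ λ _ → trans (roots-on-path true b r₀ r₁ ρ 0) (rooted zero)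
    leaf₀-rooted⇔ false true  r₀ r₁ ρ _      = iverson≡1⇔T r₀ ⇔-∘ ≡1-cong (isolated-roots r₀)
    leaf₀-rooted⇔ false false r₀ r₁ ρ _      = iverson≡1⇔T r₀ ⇔-∘ ≡1-cong (isolated-roots r₀)

    leaf₁-rooted⇔ : ∀ a b r₀ r₁ ρ → PathRooted (leafRoots a b r₀ r₁) s ρ →
      rootsLabelled (label a b s) (r₀ ∷ r₁ ∷ ρ) (label a b s (suc zero)) ≡ 1 ⇔ T (b ∨ r₁)
    leaf₁-rooted⇔ a     true  r₀ r₁ ρ rooted = mk⇔ _ λ _ → trans (roots-on-path a true r₀ r₁ ρ 0) (rooted zero)
    leaf₁-rooted⇔ true  false r₀ r₁ ρ _      = iverson≡1⇔T r₁ ⇔-∘ ≡1-cong (isolated-roots r₁)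
    leaf₁-rooted⇔ false false r₀ r₁ ρ _      = iverson≡1⇔T r₁ ⇔-∘ ≡1-cong (isolated-roots r₁)

    rootsLabelled⇔caterpillarᵇ : ∀ a b r₀ r₁ ρ →
      (∀ v → rootsLabelled (label a b s) (r₀ ∷ r₁ ∷ ρ) (label a b s v) ≡ 1) ⇔
      T (caterpillarᵇ (pathForestᵇ (λ _ → true)) (a ∷ b ∷ s) (r₀ ∷ r₁ ∷ ρ))
    rootsLabelled⇔caterpillarᵇ a b r₀ r₁ ρ = mk⇔ rooted⇒accepted accepted⇒rooted
      where
      Rooted Accepted : Set
      Rooted   = ∀ v → rootsLabelled (label a b s) (r₀ ∷ r₁ ∷ ρ) (label a b s v) ≡ 1
      Accepted = T (caterpillarᵇ (pathForestᵇ (λ _ → true)) (a ∷ b ∷ s) (r₀ ∷ r₁ ∷ ρ))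
      rooted⇒accepted : Rooted → Accepted
      rooted⇒accepted rooted =
        from T-∧ (to (leaf₀-rooted⇔ a b r₀ r₁ ρ path) (rooted zero) ,
        from T-∧ (to (leaf₁-rooted⇔ a b r₀ r₁ ρ path) (rooted (suc zero)) ,
        to (pathRooted⇔ _ s ρ) path))
        where
        path : PathRooted (leafRoots a b r₀ r₁) s ρ
        path j = trans (sym (roots-on-path a b r₀ r₁ ρ (segment s j))) (rooted (pathVertex j))
      path : Accepted → PathRooted (leafRoots a b r₀ r₁) s ρ
      path t = from (pathRooted⇔ _ s ρ) (proj₂ (to (T-∧ {b ∨ r₁}) (proj₂ (to (T-∧ {a ∨ r₀}) t))))
      accepted⇒rooted : Accepted → Rooted
      accepted⇒rooted t zero          = from (leaf₀-rooted⇔ a b r₀ r₁ ρ (path t)) (proj₁ (to (T-∧ {a ∨ r₀}) t))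
      accepted⇒rooted t (suc zero)    =
        from (leaf₁-rooted⇔ a b r₀ r₁ ρ (path t)) (proj₁ (to (T-∧ {b ∨ r₁}) (proj₂ (to (T-∧ {a ∨ r₀}) t))))
      accepted⇒rooted t (suc (suc j)) = trans (roots-on-path a b r₀ r₁ ρ (segment s j)) (path t j)

  -- The edge list T-edges k has length 2 + length (tabulate pathEdge), which is only
  -- propositionally equal to 2 + k.
  castEdges : EdgeSet (T-edges k) → Vec Bool (2 + k)
  castEdges = Vec.cast (cong (2 +_) length-pathEdges)

  Accepts : Checker k (suc k) → EdgeSet (T-edges k) × Subset (3 + k) → Set
  Accepts Q (S , R) = T (caterpillarᵇ Q (castEdges S) R)

  forest⇔caterpillarᵇ : ∀ x → IsSpanningRootedForest (T-edges k) x ⇔ Accepts (pathForestᵇ (λ _ → true)) x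
  forest⇔caterpillarᵇ (a ∷ b ∷ S′ , r₀ ∷ r₁ ∷ ρ) =
    rootsLabelled⇔caterpillarᵇ a b r₀ r₁ ρ ⇔-∘
    forest⇔rootsLabelled (T-edges k) (a ∷ b ∷ S′) (label a b (Vec.cast length-pathEdges S′))
      (acyclic edges-to-parents) connected⇔label≡ (r₀ ∷ r₁ ∷ ρ)

  rootedAt⇔caterpillarᵇ : ∀ j {Q} → (∀ e s ρ → Q e s ρ ≡ pathForestᵇ (λ _ → true) e s ρ ∧ lookup ρ j) →
    ∀ x → IsSpanningRootedForestRootedAt (T-edges k) (pathVertex j) x ⇔ Accepts Q x
  rootedAt⇔caterpillarᵇ j Q≡ (S , R@(r₀ ∷ r₁ ∷ ρ)) =
    subst (λ c → _ ⇔ T c) (sym (caterpillarᵇ-∧ Q≡ (castEdges S) r₀ r₁ ρ))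
      (⇔-sym T-∧ ⇔-∘ (forest⇔caterpillarᵇ (S , R) ×-⇔ ∈⇔T-lookup))

  HasCount-caterpillarᵇ : ∀ {P} Q → (∀ x → P x ⇔ Accepts Q x) → HasCount P (count (caterpillarᵇ Q))
  HasCount-caterpillarᵇ Q P⇔ =
    HasCount-⇔ (λ x → ⇔-sym (P⇔ x)) (HasCount-count-cast (cong (2 +_) length-pathEdges) (caterpillarᵇ Q))

theorem3 : (k : ℕ) →
    -- n = k + 3 ≥ 3, so 2n-3 = 2k+3, 2n-5 = 2k+1, 2n-4 = 2k+2
    HasCount (IsSpanningRootedForest (T-edges k)) (4 * fib (2 * k + 3)) ×
    HasCount (IsSpanningRootedForestRootedAt (T-edges k) (vertex3 k)) (4 * fib (2 * k + 1)) ×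
    HasCount (IsSpanningRootedForestRootedAt (T-edges k) (vertexN k)) (4 * fib (2 * k + 2))
theorem3 k =
  subst (HasCount _) (count-caterpillar-forests k) (HasCount-caterpillarᵇ _ forest⇔caterpillarᵇ) ,
  subst (HasCount _) (count-caterpillar-rootedFirst k)
    (HasCount-caterpillarᵇ _ (rootedAt⇔caterpillarᵇ zero λ e s ρ → ∧-comm (lookup ρ zero) _)) ,
  subst (HasCount _) (count-caterpillar-rootedLast k)
    (HasCount-caterpillarᵇ _ (rootedAt⇔caterpillarᵇ (fromℕ k) (pathForestᵇ-last id)))
  where open Caterpillar k
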